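{- Let $T$ be a rooted tree, $v$ a vertex of $T$, and $l$ an integer with $l>\mathrm{level}(v)$. Consider the Euler tour of $T$, and let $w$ be the vertex at the first position after the first occurrence of $v$ in the tour such that $\mathrm{level}(w)\ge l$. If $w$ exists and is a descendant of $v$, then for every vertex $u$: $u$ is the first level-$l$ descendant of $v$ (in preorder) if and only if $u=w$. If $w$ does not exist or is not a descendant of $v$, then $v$ has no descendant at level $l$.
   Context: The level of the root $r$ is $0$, and the level of any other vertex is one more than the level of its parent. The Euler tour of $T$ is defined as follows. Replace each tree edge by the two opposite arcs parent$\to$child and child$\to$parent. The tour is the closed walk from $r$ back to $r$ that traverses each arc exactly once, namely the depth-first traversal. It is written as the sequence of visited vertices, with repetitions. Preorder is the order in which this traversal first visits the vertices. -}

module Defs where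

open import Data.Nat using (ℕ; zero; suc; _<_; _≥_)
open import Data.List using (List; []; _∷_; _++_; map; length; lookup; [_])
open import Data.Fin using (Fin; toℕ)
open import Data.Product using (Σ; ∃; _×_; _,_)
open import Data.List.Membership.Propositional using (_∈_)
open import Relation.Binary.PropositionalEquality using (_≡_)
open import Relation.Nullary using (¬_)

data Tree : Set where
  node : List Tree → Tree

-- Vertices are identified with their addresses: the list of child
-- indices on the path from the root (the root is []).
Vertex : Set
Vertex = List ℕ

level : Vertex → ℕ
level = length

-- u is a descendant of v (reflexively): v's address is a prefix of u's.
Descendant : Vertex → Vertex → Set
Descendant u v = ∃ λ s → u ≡ v ++ s

mutual
  euler : Tree → List Vertex
  euler (node ts) = [] ∷ eulerKids 0 ts

  -- after each child subtree's tour, the walk returns to the parent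
  eulerKids : ℕ → List Tree → List Vertex
  eulerKids i [] = []
  eulerKids i (t ∷ ts) = map (i ∷_) (euler t) ++ ([] ∷ eulerKids (suc i) ts)

mutual
  preorder : Tree → List Vertex
  preorder (node ts) = [] ∷ preKids 0 ts

  preKids : ℕ → List Tree → List Vertex
  preKids i [] = []
  preKids i (t ∷ ts) = map (i ∷_) (preorder t) ++ preKids (suc i) ts

IsVertex : Tree → Vertex → Set
IsVertex T v = v ∈ preorder T

FirstOccurrence : (T : Tree) → Vertex → Fin (length (euler T)) → Set
FirstOccurrence T v i =
  lookup (euler T) i ≡ v ×
  (∀ (k : Fin (length (euler T))) → toℕ k < toℕ i → ¬ (lookup (euler T) k ≡ v))

FirstDeepAfter : (T : Tree) → Fin (length (euler T)) → ℕ → Fin (length (euler T)) → Set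
FirstDeepAfter T i l j =
  toℕ i < toℕ j ×
  level (lookup (euler T) j) ≥ l ×
  (∀ (k : Fin (length (euler T))) → toℕ i < toℕ k → toℕ k < toℕ j →
     level (lookup (euler T) k) < l)

FirstLevelDescendant : Tree → Vertex → ℕ → Vertex → Set
FirstLevelDescendant T v l u =
  Σ (Fin (length (preorder T))) λ k →
    lookup (preorder T) k ≡ u ×
    Descendant u v × level u ≡ l ×
    (∀ (k' : Fin (length (preorder T))) → toℕ k' < toℕ k →
       ¬ (Descendant (lookup (preorder T) k') v × level (lookup (preorder T) k') ≡ l))

-- The subtree of v occupies a contiguous window of both the Euler tour and
-- the preorder, every vertex outside that window is a non-descendant of v,
-- and the first occurrence of v opens its window of the Euler tour.
-- Inside the window the two traversals meet the same first vertex of level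
-- at least l: the Euler tour only inserts returns to parents, and such a
-- return is never the first deep vertex. In preorder that vertex has level
-- exactly l, because every vertex is preceded by its parent. Hence w is a
-- descendant of v precisely when v has descendants at level l, and then w is
-- the first of them in preorder.
module Submission where

open import Data.Bool using (true; false; if_then_else_)
open import Data.Fin using (Fin; zero; suc; toℕ)
open import Data.Fin.Properties using (toℕ-injective)
open import Data.List using (List; []; _∷_; _++_; map; length; lookup; find)
open import Data.List.Membership.Propositional using (_∈_; lose)
open import Data.List.Membership.Propositional.Properties using (∈-lookup; ∈-++⁻; ∈-map⁻)
open import Data.List.Properties
  using (length-++; length-map; ++-assoc; ++-identityʳ; map-++; map-∘; map-id; ∷-injectiveˡ; ∷-injectiveʳ)
open import Data.List.Relation.Unary.All as All using (All; []; _∷_)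
import Data.List.Relation.Unary.All.Properties as All
open import Data.List.Relation.Unary.Any using (Any; here; there)
open import Data.Maybe as Maybe using (just; _<∣>_)
import Data.Maybe.Relation.Unary.All as MaybeAll
import Data.Maybe.Relation.Unary.All.Properties as MaybeAll
open import Data.Nat using (ℕ; zero; suc; _≤_; _<_; _∸_; _+_; z≤n; s≤s; s≤s⁻¹)
open import Data.Nat.Properties
  using (_≤?_; _<?_; <-cmp; ≤-reflexive; <⇒≤; ≰⇒>; <⇒≱; ≮⇒≥; <⇒≢; >⇒≢; n<1+n; m<n⇒m<1+n;
         m<m+n; m<n⇒0<n∸m; m+[n∸m]≡n; +-cancelˡ-≤; +-monoʳ-<; +-monoʳ-≤)
open import Data.Product using (Σ; ∃; ∃₂; _×_; _,_)
open import Data.Sum using (_⊎_; inj₁; inj₂)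
open import Function using (_∘_)
open import Function.Bundles using (_⇔_; mk⇔)
open import Relation.Binary using (tri<; tri≈; tri>)
open import Relation.Binary.PropositionalEquality hiding (preorder)
open import Relation.Nullary using (¬_; yes; no; does; contradiction)
open import Relation.Nullary.Decidable using (does-⇔)
open import Relation.Unary using (Pred; Decidable; ∁)

open import Defs

module _ {a p} {A : Set a} {P : Pred A p} (P? : Decidable P) where

  find-++ : ∀ xs ys → find P? (xs ++ ys) ≡ find P? xs <∣> find P? ys
  find-++ []       ys = refl
  find-++ (x ∷ xs) ys with does (P? x)
  ... | true  = refl
  ... | false = find-++ xs ys

  find-just : ∀ {xs} → Any P xs → ∃ λ x → find P? xs ≡ just x
  find-just {x ∷ xs} any with P? x | any
  ... | yes _  | _          = x , refl
  ... | no ¬px | here px    = contradiction px ¬px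
  ... | no _   | there any′ = find-just any′

  find-split : ∀ {xs x} → find P? xs ≡ just x →
               ∃₂ λ ys zs → xs ≡ ys ++ x ∷ zs × All (∁ P) ys × P x
  find-split {y ∷ xs} found with P? y
  find-split {y ∷ xs} refl | yes py = [] , xs , refl , [] , py
  ... | no ¬py with find-split {xs} found
  ...   | ys , zs , refl , ¬pys , px = y ∷ ys , zs , refl , ¬py ∷ ¬pys , px

find-map : ∀ {a b p} {A : Set a} {B : Set b} {P : Pred B p} (P? : Decidable P) (f : A → B) xs →
           find P? (map f xs) ≡ Maybe.map f (find (P? ∘ f) xs)
find-map P? f []       = refl
find-map P? f (x ∷ xs) with does (P? (f x))
... | true  = refl
... | false = find-map P? f xs

find-cong : ∀ {a p q} {A : Set a} {P : Pred A p} {Q : Pred A q} (P? : Decidable P) (Q? : Decidable Q) →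
            (∀ x → P x ⇔ Q x) → ∀ xs → find P? xs ≡ find Q? xs
find-cong P? Q? P⇔Q []       = refl
find-cong P? Q? P⇔Q (x ∷ xs) rewrite does-⇔ (P⇔Q x) (P? x) (Q? x) =
  cong (λ r → if does (Q? x) then just x else r) (find-cong P? Q? P⇔Q xs)

module _ {a} {A : Set a} where

  lookup-at : ∀ {xs} X (y : A) Z → xs ≡ X ++ y ∷ Z →
              Σ (Fin (length xs)) λ k → toℕ k ≡ length X × lookup xs k ≡ y
  lookup-at []      y Z refl = zero , refl , refl
  lookup-at (x ∷ X) y Z refl with lookup-at X y Z refl
  ... | k , k≡X , k↦y = suc k , cong suc k≡X , k↦y

  lookup-∈-middle : ∀ {xs} X Y (Z : List A) → xs ≡ X ++ Y ++ Z → (k : Fin (length xs)) →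
                    length X ≤ toℕ k → toℕ k < length X + length Y → lookup xs k ∈ Y
  lookup-∈-middle []      []      Z refl k       _         ()
  lookup-∈-middle []      (y ∷ Y) Z refl zero    _         _ = here refl
  lookup-∈-middle []      (y ∷ Y) Z refl (suc k) _         (s≤s k<Y) =
    there (lookup-∈-middle [] Y Z refl k z≤n k<Y)
  lookup-∈-middle (x ∷ X) Y       Z refl (suc k) (s≤s X≤k) (s≤s k<XY) =
    lookup-∈-middle X Y Z refl k X≤k k<XY

Minimal : ∀ {n p} → Pred (Fin n) p → Pred (Fin n) p
Minimal P j = P j × (∀ k → toℕ k < toℕ j → ¬ P k)

minimal-unique : ∀ {n p} {P : Pred (Fin n) p} {j k} → Minimal P j → Minimal P k → j ≡ k
minimal-unique {j = j} {k} (pj , j-min) (pk , k-min) with <-cmp (toℕ j) (toℕ k)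
... | tri< j<k _ _ = contradiction pj (k-min j j<k)
... | tri≈ _ j≡k _ = toℕ-injective j≡k
... | tri> _ _ k<j = contradiction pk (j-min k k<j)

first-deep-after-unique : ∀ T {i l j j′} → FirstDeepAfter T i l j → FirstDeepAfter T i l j′ → j ≡ j′
first-deep-after-unique T {i} {l} j-first j′-first = minimal-unique (minimal j-first) (minimal j′-first)
  where
  minimal : ∀ {j} → FirstDeepAfter T i l j →
            Minimal (λ k → toℕ i < toℕ k × l ≤ level (lookup (euler T) k)) j
  minimal (i<j , j-deep , between) =
    (i<j , j-deep) , λ k k<j (i<k , k-deep) → <⇒≱ (between k i<k k<j) k-deep

first-level-descendant-unique : ∀ T {v l u u′} →
  FirstLevelDescendant T v l u → FirstLevelDescendant T v l u′ → u ≡ u′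
first-level-descendant-unique T {v} {l} (k , k↦u , u-desc , u-level , k-min)
                                        (k′ , k′↦u′ , u′-desc , u′-level , k′-min) =
  trans (sym k↦u) (trans (cong (lookup (preorder T)) k≡k′) k′↦u′)
  where
  Target : Vertex → Set
  Target w = Descendant w v × level w ≡ l
  k≡k′ : k ≡ k′
  k≡k′ = minimal-unique (subst Target (sym k↦u) (u-desc , u-level) , k-min)
                        (subst Target (sym k′↦u′) (u′-desc , u′-level) , k′-min)

Outside : Vertex → Vertex → Set
Outside v x = ¬ Descendant x v

descendant-refl : ∀ v → Descendant v v
descendant-refl v = [] , sym (++-identityʳ v)

root-outside : ∀ {c v} → Outside (c ∷ v) []
root-outside (_ , ())

∷-outside : ∀ {k v x} → Outside v x → Outside (k ∷ v) (k ∷ x)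
∷-outside x-out (s , eq) = x-out (s , ∷-injectiveʳ eq)

head-outside : ∀ {k c v x} → k ≢ c → Outside (c ∷ v) (k ∷ x)
head-outside k≢c (_ , eq) = k≢c (∷-injectiveˡ eq)

map-∷-outside : ∀ {k c v} → k ≢ c → ∀ xs → All (Outside (c ∷ v)) (map (k ∷_) xs)
map-∷-outside k≢c xs = All.map⁺ (All.universal (λ _ → head-outside k≢c) xs)

eulerKids-outside : ∀ {c v k} → c < k → ∀ ts → All (Outside (c ∷ v)) (eulerKids k ts)
eulerKids-outside c<k []       = []
eulerKids-outside c<k (t ∷ ts) =
  All.++⁺ (map-∷-outside (>⇒≢ c<k) (euler t)) (root-outside ∷ eulerKids-outside (m<n⇒m<1+n c<k) ts)

preKids-outside : ∀ {c v k} → c < k → ∀ ts → All (Outside (c ∷ v)) (preKids k ts)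
preKids-outside c<k []       = []
preKids-outside c<k (t ∷ ts) =
  All.++⁺ (map-∷-outside (>⇒≢ c<k) (preorder t)) (preKids-outside (m<n⇒m<1+n c<k) ts)

preKids-lower-bound : ∀ {c v k} ts → (c ∷ v) ∈ preKids k ts → k ≤ c
preKids-lower-bound ts v∈ = ≮⇒≥ λ c<k → All.lookup (preKids-outside c<k ts) v∈ (descendant-refl _)

record Window (v : Vertex) (xs ys : List Vertex) : Set where
  constructor window
  field
    before after   : List Vertex
    split          : xs ≡ before ++ map (v ++_) ys ++ after
    before-outside : All (Outside v) before
    after-outside  : All (Outside v) after

window-root : ∀ xs → Window [] xs xs
window-root xs = window [] [] (sym (trans (++-identityʳ _) (map-id xs))) [] []

window-prepend : ∀ {v xs ys L} → All (Outside v) L → Window v xs ys → Window v (L ++ xs) ys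
window-prepend {L = L} L-out (window A B split A-out B-out) =
  window (L ++ A) B (trans (cong (L ++_) split) (sym (++-assoc L A _))) (All.++⁺ L-out A-out) B-out

window-under : ∀ {v xs ys R} k → All (Outside (k ∷ v)) R → Window v xs ys →
               Window (k ∷ v) (map (k ∷_) xs ++ R) ys
window-under {v} {xs} {ys} {R} k R-out (window A B split A-out B-out) =
  window (map (k ∷_) A) (map (k ∷_) B ++ R) reassociated
         (All.map⁺ (All.map ∷-outside A-out)) (All.++⁺ (All.map⁺ (All.map ∷-outside B-out)) R-out)
  where
  open ≡-Reasoning
  Aᵏ = map (k ∷_) A
  Yᵏ = map ((k ∷ v) ++_) ys
  Bᵏ = map (k ∷_) B
  reassociated : map (k ∷_) xs ++ R ≡ Aᵏ ++ Yᵏ ++ Bᵏ ++ R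
  reassociated = begin
    map (k ∷_) xs ++ R                              ≡⟨ cong (λ zs → map (k ∷_) zs ++ R) split ⟩
    map (k ∷_) (A ++ map (v ++_) ys ++ B) ++ R      ≡⟨ cong (_++ R) (map-++ (k ∷_) A _) ⟩
    (Aᵏ ++ map (k ∷_) (map (v ++_) ys ++ B)) ++ R
      ≡⟨ cong (λ zs → (Aᵏ ++ zs) ++ R) (map-++ (k ∷_) (map (v ++_) ys) B) ⟩
    (Aᵏ ++ map (k ∷_) (map (v ++_) ys) ++ Bᵏ) ++ R  ≡⟨ cong (λ zs → (Aᵏ ++ zs ++ Bᵏ) ++ R) (map-∘ ys) ⟨
    (Aᵏ ++ Yᵏ ++ Bᵏ) ++ R                           ≡⟨ ++-assoc Aᵏ (Yᵏ ++ Bᵏ) R ⟩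
    Aᵏ ++ (Yᵏ ++ Bᵏ) ++ R                           ≡⟨ cong (Aᵏ ++_) (++-assoc Yᵏ Bᵏ R) ⟩
    Aᵏ ++ Yᵏ ++ Bᵏ ++ R                             ∎

window-descendant : ∀ {v xs ys u} → Window v xs ys → u ∈ xs → Descendant u v →
                    ∃ λ y → y ∈ ys × u ≡ v ++ y
window-descendant {v} {ys = ys} (window A B refl A-out B-out) u∈ u-desc with ∈-++⁻ A u∈
... | inj₁ u∈A = contradiction u-desc (All.lookup A-out u∈A)
... | inj₂ u∈YB with ∈-++⁻ (map (v ++_) ys) u∈YB
...   | inj₁ u∈Y = ∈-map⁻ (v ++_) u∈Y
...   | inj₂ u∈B = contradiction u-desc (All.lookup B-out u∈B)

window-split : ∀ {v xs ys Y₁ y Y₂} (w : Window v xs ys) → ys ≡ Y₁ ++ y ∷ Y₂ →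
               xs ≡ (Window.before w ++ map (v ++_) Y₁) ++ (v ++ y) ∷ (map (v ++_) Y₂ ++ Window.after w)
window-split {v} {Y₁ = Y₁} {y} {Y₂} (window A B refl _ _) refl = begin
  A ++ map (v ++_) (Y₁ ++ y ∷ Y₂) ++ B
    ≡⟨ cong (λ zs → A ++ zs ++ B) (map-++ (v ++_) Y₁ (y ∷ Y₂)) ⟩
  A ++ (map (v ++_) Y₁ ++ (v ++ y) ∷ map (v ++_) Y₂) ++ B
    ≡⟨ cong (A ++_) (++-assoc (map (v ++_) Y₁) _ B) ⟩
  A ++ map (v ++_) Y₁ ++ (v ++ y) ∷ map (v ++_) Y₂ ++ B
    ≡⟨ ++-assoc A (map (v ++_) Y₁) _ ⟨
  (A ++ map (v ++_) Y₁) ++ (v ++ y) ∷ map (v ++_) Y₂ ++ B ∎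
  where open ≡-Reasoning

record SubtreeWindows (v : Vertex) (es ps : List Vertex) : Set where
  constructor subtreeWindows
  field
    subtree        : Tree
    eulerWindow    : Window v es (euler subtree)
    preorderWindow : Window v ps (preorder subtree)

windows-prepend : ∀ {v es ps L L′} → All (Outside v) L → All (Outside v) L′ →
                  SubtreeWindows v es ps → SubtreeWindows v (L ++ es) (L′ ++ ps)
windows-prepend L-out L′-out (subtreeWindows t ew pw) =
  subtreeWindows t (window-prepend L-out ew) (window-prepend L′-out pw)

windows-under : ∀ {v es ps R R′} k → All (Outside (k ∷ v)) R → All (Outside (k ∷ v)) R′ →
                SubtreeWindows v es ps →
                SubtreeWindows (k ∷ v) (map (k ∷_) es ++ R) (map (k ∷_) ps ++ R′)
windows-under k R-out R′-out (subtreeWindows t ew pw) =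
  subtreeWindows t (window-under k R-out ew) (window-under k R′-out pw)

mutual
  subtree-windows : ∀ T v → IsVertex T v → SubtreeWindows v (euler T) (preorder T)
  subtree-windows T          []      _         = subtreeWindows T (window-root _) (window-root _)
  subtree-windows (node ts)  (c ∷ v) (there v∈) =
    windows-prepend (root-outside ∷ []) (root-outside ∷ []) (kids-windows 0 ts v∈)

  kids-windows : ∀ k ts {c v} → (c ∷ v) ∈ preKids k ts →
                 SubtreeWindows (c ∷ v) (eulerKids k ts) (preKids k ts)
  kids-windows k (t ∷ ts) v∈ with ∈-++⁻ (map (k ∷_) (preorder t)) v∈
  ... | inj₁ v∈t with ∈-map⁻ (k ∷_) v∈t
  ...   | x , x∈t , refl =
    windows-under k (root-outside ∷ eulerKids-outside (n<1+n k) ts) (preKids-outside (n<1+n k) ts)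
                  (subtree-windows t x x∈t)
  kids-windows k (t ∷ ts) v∈ | inj₂ v∈ts =
    windows-prepend (map-∷-outside k≢c (euler t)) (map-∷-outside k≢c (preorder t))
      (windows-prepend (root-outside ∷ []) [] (kids-windows (suc k) ts v∈ts))
    where
    k≢c = <⇒≢ (preKids-lower-bound ts v∈ts)

Deep : ℕ → Pred Vertex _
Deep m x = m ≤ level x

deep? : ∀ m → Decidable (Deep m)
deep? m x = m ≤? level x

find-deep-map-∷ : ∀ m k xs →
                  find (deep? (suc m)) (map (k ∷_) xs) ≡ Maybe.map (k ∷_) (find (deep? m) xs)
find-deep-map-∷ m k xs =
  trans (find-map (deep? (suc m)) (k ∷_) xs)
        (cong (Maybe.map (k ∷_)) (find-cong _ (deep? m) (λ _ → mk⇔ s≤s⁻¹ s≤s) xs))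

mutual
  find-deep-euler≡preorder : ∀ m t → find (deep? m) (euler t) ≡ find (deep? m) (preorder t)
  find-deep-euler≡preorder zero    (node ts) = refl
  find-deep-euler≡preorder (suc m) (node ts) = find-deep-eulerKids≡preKids m 0 ts

  find-deep-eulerKids≡preKids : ∀ m k ts →
    find (deep? (suc m)) (eulerKids k ts) ≡ find (deep? (suc m)) (preKids k ts)
  find-deep-eulerKids≡preKids m k []       = refl
  find-deep-eulerKids≡preKids m k (t ∷ ts) = begin
    find d (map (k ∷_) (euler t) ++ [] ∷ eulerKids (suc k) ts)
      ≡⟨ find-++ d (map (k ∷_) (euler t)) _ ⟩
    find d (map (k ∷_) (euler t)) <∣> find d (eulerKids (suc k) ts)
      ≡⟨ cong (_<∣> find d (eulerKids (suc k) ts)) (find-deep-map-∷ m k (euler t)) ⟩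
    Maybe.map (k ∷_) (find (deep? m) (euler t)) <∣> find d (eulerKids (suc k) ts)
      ≡⟨ cong₂ (λ r s → Maybe.map (k ∷_) r <∣> s)
               (find-deep-euler≡preorder m t) (find-deep-eulerKids≡preKids m (suc k) ts) ⟩
    Maybe.map (k ∷_) (find (deep? m) (preorder t)) <∣> find d (preKids (suc k) ts)
      ≡⟨ cong (_<∣> find d (preKids (suc k) ts)) (find-deep-map-∷ m k (preorder t)) ⟨
    find d (map (k ∷_) (preorder t)) <∣> find d (preKids (suc k) ts)
      ≡⟨ find-++ d (map (k ∷_) (preorder t)) _ ⟨
    find d (map (k ∷_) (preorder t) ++ preKids (suc k) ts)             ∎
    where
    open ≡-Reasoning
    d = deep? (suc m)

mutual
  find-deep-preorder-exact : ∀ m t → MaybeAll.All (λ x → level x ≡ m) (find (deep? m) (preorder t))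
  find-deep-preorder-exact zero    (node ts) = MaybeAll.just refl
  find-deep-preorder-exact (suc m) (node ts) = find-deep-preKids-exact m 0 ts

  find-deep-preKids-exact : ∀ m k ts →
    MaybeAll.All (λ x → level x ≡ suc m) (find (deep? (suc m)) (preKids k ts))
  find-deep-preKids-exact m k []       = MaybeAll.nothing
  find-deep-preKids-exact m k (t ∷ ts) =
    subst (MaybeAll.All _) (sym (find-++ (deep? (suc m)) (map (k ∷_) (preorder t)) _))
      (MaybeAll.<∣>⁺
        (subst (MaybeAll.All _) (sym (find-deep-map-∷ m k (preorder t)))
               (MaybeAll.gmap (cong suc) (find-deep-preorder-exact m t)))
        (find-deep-preKids-exact m (suc k) ts))

euler-root-first : ∀ t → ∃ λ rest → euler t ≡ [] ∷ rest
euler-root-first (node ts) = eulerKids 0 ts , refl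

module FirstDeepDescendant (T : Tree) (v : Vertex) (v∈T : IsVertex T v) (l : ℕ) (v<l : level v < l) where

  open SubtreeWindows (subtree-windows T v v∈T) renaming (subtree to t)
  open Window eulerWindow using ()
    renaming (before to A; after to B; split to euler-split; before-outside to A-outside)
  open Window preorderWindow using ()
    renaming (before to P; split to preorder-split; before-outside to P-outside)

  m : ℕ
  m = l ∸ level v

  level-v+m : level v + m ≡ l
  level-v+m = m+[n∸m]≡n (<⇒≤ v<l)

  shallow-lift : ∀ {x} → ¬ Deep m x → level (v ++ x) < l
  shallow-lift {x} x-shallow =
    subst₂ _<_ (sym (length-++ v)) level-v+m (+-monoʳ-< (level v) (≰⇒> x-shallow))

  deep-lift : ∀ {x} → Deep m x → l ≤ level (v ++ x)
  deep-lift {x} x-deep = subst₂ _≤_ level-v+m (sym (length-++ v)) (+-monoʳ-≤ (level v) x-deep)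

  deep-lower : ∀ {x} → l ≤ level (v ++ x) → Deep m x
  deep-lower {x} deep = +-cancelˡ-≤ (level v) m (level x) (subst₂ _≤_ (sym level-v+m) (length-++ v) deep)

  deep-has-predecessor : ∀ {L₁ x L₂} → euler t ≡ L₁ ++ x ∷ L₂ → Deep m x → 0 < length L₁
  deep-has-predecessor {[]} split x-deep with euler-root-first t
  ... | _ , root-first =
    contradiction (subst (Deep m) (∷-injectiveˡ (trans (sym split) root-first)) x-deep) (<⇒≱ (m<n⇒0<n∸m v<l))
  deep-has-predecessor {_ ∷ _} _ _ = s≤s z≤n

  first-occurrence-index : ∀ {i} → FirstOccurrence T v i → toℕ i ≡ length A
  first-occurrence-index {i} (i↦v , i-first) with <-cmp (toℕ i) (length A)
  ... | tri< i<A _ _ = contradiction (descendant-refl v)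
    (All.lookup A-outside (subst (_∈ A) i↦v (lookup-∈-middle [] A _ euler-split i z≤n i<A)))
  ... | tri≈ _ i≡A _ = i≡A
  ... | tri> _ _ A<i with euler-root-first t
  ...   | _ , root-first
    with lookup-at A (v ++ []) _ (trans euler-split (cong (λ zs → A ++ map (v ++_) zs ++ B) root-first))
  ...     | k , k≡A , k↦v =
    contradiction (trans k↦v (++-identityʳ v)) (i-first k (subst (_< toℕ i) (sym k≡A) A<i))

  first-deep-after-found : ∀ {i x} → FirstOccurrence T v i → find (deep? m) (euler t) ≡ just x →
                           ∃ λ j → FirstDeepAfter T i l j × lookup (euler T) j ≡ v ++ x
  first-deep-after-found {i} {x} i-occ found with find-split (deep? m) found
  ... | L₁ , L₂ , t-split , L₁-shallow , x-deep
    with lookup-at (A ++ map (v ++_) L₁) (v ++ x) _ (window-split eulerWindow t-split)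
  ...   | j , j≡ , j↦vx =
    j , (i<j , subst (λ w → l ≤ level w) (sym j↦vx) (deep-lift x-deep) , between) , j↦vx
    where
    i≡A = first-occurrence-index i-occ
    j≡A+L₁ : toℕ j ≡ length A + length (map (v ++_) L₁)
    j≡A+L₁ = trans j≡ (length-++ A)
    i<j : toℕ i < toℕ j
    i<j = subst₂ _<_ (sym i≡A) (sym j≡A+L₁)
            (m<m+n (length A) (subst (0 <_) (sym (length-map (v ++_) L₁)) (deep-has-predecessor t-split x-deep)))
    between : ∀ k → toℕ i < toℕ k → toℕ k < toℕ j → level (lookup (euler T) k) < l
    between k i<k k<j with ∈-map⁻ (v ++_) (lookup-∈-middle A (map (v ++_) L₁) _
                              (trans (window-split eulerWindow t-split) (++-assoc A _ _)) k
                              (<⇒≤ (subst (_< toℕ k) i≡A i<k)) (subst (toℕ k <_) j≡A+L₁ k<j))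
    ... | y , y∈L₁ , k↦vy =
      subst (λ w → level w < l) (sym k↦vy) (shallow-lift (All.lookup L₁-shallow y∈L₁))

  first-level-descendant-found : ∀ {x} → find (deep? m) (preorder t) ≡ just x →
                                 FirstLevelDescendant T v l (v ++ x)
  first-level-descendant-found {x} found with find-split (deep? m) found
  ... | M₁ , M₂ , t-split , M₁-shallow , _
    with lookup-at (P ++ map (v ++_) M₁) (v ++ x) _ (window-split preorderWindow t-split)
  ...   | k , k≡ , k↦vx = k , k↦vx , (x , refl) , vx-level , earlier
    where
    vx-level : level (v ++ x) ≡ l
    vx-level = trans (length-++ v) (trans (cong (level v +_) x-level) level-v+m)
      where
      x-level = MaybeAll.drop-just (subst (MaybeAll.All _) found (find-deep-preorder-exact m t))
    earlier : ∀ k′ → toℕ k′ < toℕ k →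
              ¬ (Descendant (lookup (preorder T) k′) v × level (lookup (preorder T) k′) ≡ l)
    earlier k′ k′<k (k′-desc , k′-level) with toℕ k′ <? length P
    ... | yes k′<P = All.lookup P-outside (lookup-∈-middle [] P _ preorder-split k′ z≤n k′<P) k′-desc
    ... | no k′≮P with ∈-map⁻ (v ++_) (lookup-∈-middle P (map (v ++_) M₁) _
                         (trans (window-split preorderWindow t-split) (++-assoc P _ _)) k′
                         (≮⇒≥ k′≮P) (subst (toℕ k′ <_) (trans k≡ (length-++ P)) k′<k))
    ...   | y , y∈M₁ , k′↦vy =
      <⇒≢ (shallow-lift (All.lookup M₁-shallow y∈M₁)) (trans (cong level (sym k′↦vy)) k′-level)

  first-level-descendant-iff : ∀ {i} → FirstOccurrence T v i →
    (j : Fin (length (euler T))) → FirstDeepAfter T i l j → Descendant (lookup (euler T) j) v →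
    (u : Vertex) → FirstLevelDescendant T v l u ⇔ (u ≡ lookup (euler T) j)
  first-level-descendant-iff i-occ j j-first@(_ , j-deep , _) j-desc u
    with window-descendant eulerWindow (∈-lookup j) j-desc
  ... | y , y∈t , j↦vy
    with find-just (deep? m) (lose y∈t (deep-lower (subst (λ w → l ≤ level w) j↦vy j-deep)))
  ...   | x , found with first-deep-after-found i-occ found
  ...     | j* , j*-first , j*↦vx =
    mk⇔ (λ u-first → trans (first-level-descendant-unique T u-first vx-first) (sym j↦vx))
        (λ u≡j → subst (FirstLevelDescendant T v l) (sym (trans u≡j j↦vx)) vx-first)
    where
    vx-first = first-level-descendant-found (trans (sym (find-deep-euler≡preorder m t)) found)
    j↦vx = trans (cong (lookup (euler T)) (first-deep-after-unique T j-first j*-first)) j*↦vx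

  no-level-descendant : ∀ {i} → FirstOccurrence T v i →
    (¬ (∃ λ j → FirstDeepAfter T i l j)
      ⊎ (∃ λ j → FirstDeepAfter T i l j × ¬ Descendant (lookup (euler T) j) v)) →
    ¬ (∃ λ u → IsVertex T u × Descendant u v × level u ≡ l)
  no-level-descendant i-occ no-first (u , u∈T , u-desc , u-level)
    with window-descendant preorderWindow u∈T u-desc
  ... | s , s∈t , refl with find-just (deep? m) (lose s∈t (deep-lower (≤-reflexive (sym u-level))))
  ...   | x , found-pre
    with first-deep-after-found i-occ (trans (find-deep-euler≡preorder m t) found-pre)
  ...     | j* , j*-first , j*↦vx with no-first
  ...       | inj₁ none = none (j* , j*-first)
  ...       | inj₂ (j , j-first , j-not-desc) =
    j-not-desc (subst (λ k → Descendant (lookup (euler T) k) v)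
                      (sym (first-deep-after-unique T j-first j*-first)) (x , j*↦vx))

mainTheorem8 : (T : Tree) (v : Vertex) (l : ℕ) →
    IsVertex T v → level v < l →
    (i : Fin (length (euler T))) → FirstOccurrence T v i →
    ((j : Fin (length (euler T))) → FirstDeepAfter T i l j →
       Descendant (lookup (euler T) j) v →
       (u : Vertex) → FirstLevelDescendant T v l u ⇔ (u ≡ lookup (euler T) j))
    ×
    ((¬ (∃ λ j → FirstDeepAfter T i l j)
       ⊎ (∃ λ j → FirstDeepAfter T i l j × ¬ Descendant (lookup (euler T) j) v)) →
       ¬ (∃ λ u → IsVertex T u × Descendant u v × level u ≡ l))
mainTheorem8 T v l v∈T v<l i i-occ = first-level-descendant-iff i-occ , no-level-descendant i-occ
  where open FirstDeepDescendant T v v∈T l v<l
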